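{- Let $G$ be a connected graph on $n$ vertices and let $(v_1,\dots,v_n)$ be an ordering of $V(G)$ such that each $v_i$ with $i\ge 2$ has a neighbor among $v_1,\dots,v_{i-1}$. Then $$\hat{p}(G)\ge \min_{T\in\mathbf{T}}\sum_{v\in T}d^-(v),$$ where $\mathbf{T}$ is the family of subsets of $V(G)$ that are saturating with respect to $(v_1,\dots,v_n)$.
   Context: For an ordering $(v_1,\dots,v_n)$ of $V(G)$, the back-degree $d^-(v_i)$ is the number of neighbors of $v_i$ among $v_1,\dots,v_{i-1}$ (so $d^-(v_1)=0$). A set $T\subseteq V(G)$ is saturating with respect to the ordering if $|T\cap\{v_2,\dots,v_k\}|\ge\log_2 k$ for every $k\le n$. An edge-coloring assigns a color to each edge; a walk is a parity walk if every color appears an even number of times along it (with multiplicity), and open if its endpoints are distinct. A strong parity edge-coloring is an edge-coloring with no open parity walk, and $\hat{p}(G)$ is the minimum number of colors in such a coloring. -}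

module Defs where

open import Data.Nat using (ℕ; zero; suc; _+_; _≤_; _<_)
open import Data.Nat.Divisibility using (_∣_)
import Data.Nat
import Data.Bool
open import Data.Nat.Logarithm using (⌈log₂_⌉)
open import Data.Fin using (Fin; toℕ)
open import Data.Fin.Permutation using (Permutation′; _⟨$⟩ʳ_)
open import Data.Bool using (Bool; true; false; if_then_else_)
open import Data.List using (List; []; _∷_; length; filter; allFin; map)
open import Data.Nat.ListAction using (sum)
open import Data.Product using (Σ; _×_; ∃)
open import Relation.Binary.PropositionalEquality using (_≡_; _≢_)
open import Relation.Nullary using (¬_)
open import Data.Fin using (_≟_)

record Graph (n : ℕ) : Set where
  field
    adj   : Fin n → Fin n → Bool
    sym   : ∀ u v → adj u v ≡ adj v u
    irref : ∀ v → adj v v ≡ false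
open Graph public

data Walk {n : ℕ} (G : Graph n) (u : Fin n) : Fin n → Set where
  here : Walk G u u
  step : ∀ {v w} → Walk G u v → adj G v w ≡ true → Walk G u w

Connected : ∀ {n} → Graph n → Set
Connected {n} G = ∀ (u v : Fin n) → Walk G u v

-- An edge-coloring of G with (at most) k colors: a color for each edge {u,v},
-- independent of the orientation (values on non-edges are irrelevant).
record EdgeColoring {n : ℕ} (G : Graph n) (k : ℕ) : Set where
  field
    col     : Fin n → Fin n → Fin k
    col-sym : ∀ u v → adj G u v ≡ true → col u v ≡ col v u
open EdgeColoring public

walkColors : ∀ {n k} {G : Graph n} → EdgeColoring G k → ∀ {u v} → Walk G u v → List (Fin k)
walkColors c here = []
walkColors c (step {v = v} {w = w} p _) = col c v w ∷ walkColors c p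

count : ∀ {k} → Fin k → List (Fin k) → ℕ
count a xs = length (filter (λ b → a ≟ b) xs)

IsParityWalk : ∀ {n k} {G : Graph n} → EdgeColoring G k → ∀ {u v} → Walk G u v → Set
IsParityWalk {k = k} c p = ∀ (a : Fin k) → 2 ∣ count a (walkColors c p)

IsStrongParity : ∀ {n k} {G : Graph n} → EdgeColoring G k → Set
IsStrongParity {n} {G = G} c = ∀ (u v : Fin n) (p : Walk G u v) → u ≢ v → ¬ IsParityWalk c p

countFin : ∀ n → (Fin n → Bool) → ℕ
countFin n P = length (filter (λ i → P i Data.Bool.≟ true) (allFin n))

sumFin : ∀ n → (Fin n → ℕ) → ℕ
sumFin n f = sum (map f (allFin n))

-- Ordering (v_1,…,v_n) given by a permutation σ : position i (0-based) ↦ v_{i+1}.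
-- Back-degree of the vertex at position i: neighbours at earlier positions.
backDeg : ∀ {n} → Graph n → Permutation′ n → Fin n → ℕ
backDeg {n} G σ i =
  countFin n (λ j → if toℕ j Data.Nat.<ᵇ toℕ i then adj G (σ ⟨$⟩ʳ j) (σ ⟨$⟩ʳ i) else false)

GoodOrdering : ∀ {n} → Graph n → Permutation′ n → Set
GoodOrdering {n} G σ = ∀ (i : Fin n) → 1 ≤ toℕ i →
  ∃ λ (j : Fin n) → toℕ j < toℕ i × adj G (σ ⟨$⟩ʳ j) (σ ⟨$⟩ʳ i) ≡ true

-- |T ∩ {v_2,…,v_k}| : vertices at 0-based positions i with 1 ≤ i < k.
satCount : ∀ {n} → Permutation′ n → (Fin n → Bool) → ℕ → ℕ
satCount {n} σ T k =
  countFin n (λ i → if (0 Data.Nat.<ᵇ toℕ i) Data.Bool.∧ (toℕ i Data.Nat.<ᵇ k) then T (σ ⟨$⟩ʳ i) else false)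

-- T is saturating: |T ∩ {v_2,…,v_k}| ≥ log₂ k for all 1 ≤ k ≤ n
-- (for a natural number count this is equivalent to ≥ ⌈log₂ k⌉).
Saturating : ∀ {n} → Permutation′ n → (Fin n → Bool) → Set
Saturating {n} σ T = ∀ (k : ℕ) → 1 ≤ k → k ≤ n → ⌈log₂ k ⌉ ≤ satCount σ T k

sumBackDeg : ∀ {n} → Graph n → Permutation′ n → (Fin n → Bool) → ℕ
sumBackDeg {n} G σ T = sumFin n (λ i → if T (σ ⟨$⟩ʳ i) then backDeg G σ i else 0)

-- Colour parities of walks are vectors in 𝔽₂ᵏ. Fixing a walk from the root r = v₁ to every
-- vertex v gives a potential π(v); the parities of closed walks at r form the span C of π(r)
-- and of the vectors π(u) + e(col uw) + π(w) of the edges uw. Strong parity means that no open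
-- walk has parity 0, i.e. the potentials of distinct vertices are distinct modulo C.
--
-- Put vᵢ into T when π(vᵢ) is not in the span of C and the earlier potentials. Then π(v₁), …,
-- π(v_K) are K vectors, pairwise inequivalent modulo C, in the span of C and the potentials of
-- T ∩ {v₂, …, v_K}, so K ≤ 2^|T ∩ {v₂, …, v_K}|.
--
-- The colour e(col uv) of a back edge at vᵢ lies in the span of C and π(v₁), …, π(vᵢ), so no
-- back edge at a later vertex of T can repeat it: that vertex's potential would then lie in
-- this span too. Two back edges at one vertex with the same colour form an open parity walk of
-- length 2. So the back edges at vertices of T have pairwise distinct colours.
module Submission where

open import Defs renaming (sym to adj-sym)

open import Data.Bool using (Bool; true; false; not; _∧_; _∨_; _xor_; if_then_else_; T; T?)
open import Data.Bool.Properties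
  using (xor-assoc; xor-comm; xor-identityˡ; xor-identityʳ; xor-same; ∧-zeroʳ; T-≡; T-∨)
  renaming (_≟_ to _≟ᵇ_)
open import Data.Empty using (⊥-elim)
open import Data.Fin using (Fin; toℕ) renaming (zero to fzero; suc to fsuc; _≟_ to _≟ᶠ_)
open import Data.Fin.Permutation using (Permutation′; _⟨$⟩ʳ_; _⟨$⟩ˡ_; inverseˡ)
open import Data.Fin.Properties using (pigeonhole; toℕ-fromℕ<; toℕ-injective; toℕ<n)
open import Data.List using (List; []; _∷_; _++_; length; map; filter; applyUpTo; allFin)
import Data.List as List
open import Data.List.Membership.Propositional using (_∈_)
open import Data.List.Membership.Propositional.Properties
  using (∈-concat⁺′; ∈-tabulate⁺; ∈-lookup; ∈-map⁻; ∈-filter⁻)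
open import Data.List.Properties using (length-map; length-applyUpTo; length-++; map-cong; map-∘)
open import Data.List.Relation.Binary.Disjoint.Propositional using (Disjoint)
open import Data.List.Relation.Unary.All using (All; []; _∷_)
import Data.List.Relation.Unary.All as All
import Data.List.Relation.Unary.All.Properties as Allₚ
open import Data.List.Relation.Unary.AllPairs using (AllPairs; []; _∷_)
import Data.List.Relation.Unary.AllPairs as AllPairs
import Data.List.Relation.Unary.AllPairs.Properties as AllPairsₚ
open import Data.List.Relation.Unary.Any using (here; there)
open import Data.List.Relation.Unary.Unique.Propositional using (Unique)
import Data.List.Relation.Unary.Unique.Propositional.Properties as Uniqueₚ
open import Data.Nat
  using (ℕ; zero; suc; _+_; _^_; _≤_; _<_; _≤′_; ≤′-refl; ≤′-step; _<ᵇ_; z≤n; s≤s)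
open import Data.Nat.DivMod using (_mod_; m<n⇒m%n≡m)
open import Data.Nat.Divisibility using (_∣_; divides-refl; ∣m∣n⇒∣m+n; ∣-refl)
open import Data.Nat.ListAction using (sum)
open import Data.Nat.Logarithm using (⌈log₂_⌉; ⌈log₂⌉-mono-≤; ⌈log₂2^n⌉≡n)
open import Data.Nat.Properties
  using ( +-suc; +-identityʳ; +-mono-≤; +-commutativeSemigroup; ≤-refl; ≤-trans; <-trans; <-cmp
        ; m≤n⇒m≤1+n; <⇒≢; ≤⇒≯; ≰⇒>; _≤?_; ≤⇒≤′; ≤′⇒≤; <ᵇ⇒<; <⇒<ᵇ; module ≤-Reasoning)
open import Algebra.Properties.CommutativeSemigroup +-commutativeSemigroup using (x∙yz≈y∙xz)
open import Data.Product using (Σ; _×_; _,_; proj₂)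
open import Data.Sum using (_⊎_; inj₁; inj₂)
open import Data.Vec using (Vec; []; _∷_; zipWith; replicate; tabulate; lookup)
open import Data.Vec.Properties
  using ( zipWith-assoc; zipWith-comm; zipWith-identityˡ; zipWith-identityʳ; ≡-dec
        ; lookup-zipWith; lookup-replicate; lookup∘tabulate)
open import Function using (_∘_; id)
open import Function.Bundles using (Equivalence; Injection)
open import Function.Properties.Inverse using (↔⇒↣)
open import Relation.Binary.Definitions using (tri<; tri≈; tri>)
open import Relation.Binary.PropositionalEquality
open import Relation.Nullary using (¬_; yes; no; contradiction)
open import Relation.Nullary.Decidable using (isYes; toWitness; fromWitness)
open import Relation.Unary using (Decidable)
open import Relation.Unary.Properties using (∁?)

length-filter-∁ : ∀ {a p} {A : Set a} {P : A → Set p} (P? : Decidable P) xs →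
                  length (filter P? xs) + length (filter (∁? P?) xs) ≡ length xs
length-filter-∁ P? []       = refl
length-filter-∁ P? (x ∷ xs) with P? x
... | yes _ = cong suc (length-filter-∁ P? xs)
... | no  _ = trans (+-suc _ _) (cong suc (length-filter-∁ P? xs))

length-concat : ∀ {a} {A : Set a} (xss : List (List A)) →
                length (List.concat xss) ≡ sum (map length xss)
length-concat []         = refl
length-concat (xs ∷ xss) = trans (length-++ xs) (cong (length xs +_) (length-concat xss))

Unique-map⁺ : ∀ {a b p} {A : Set a} {B : Set b} {P : A → Set p} {f : A → B} {xs} → All P xs →
              (∀ {x y} → P x → P y → x ≢ y → f x ≢ f y) → Unique xs → Unique (map f xs)
Unique-map⁺ []         f-inj []           = []
Unique-map⁺ (px ∷ pxs) f-inj (x∉xs ∷ xs!) =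
  Allₚ.map⁺ (All.zipWith (λ (py , x≢y) → f-inj px py x≢y) (pxs , x∉xs)) ∷ Unique-map⁺ pxs f-inj xs!

Unique⇒length≤ : ∀ {k} (xs : List (Fin k)) → Unique xs → length xs ≤ k
Unique⇒length≤ {k} xs xs! with length xs ≤? k
... | yes xs≤k = xs≤k
... | no  xs≰k with pigeonhole (≰⇒> xs≰k) (List.lookup xs)
...   | i , j , i<j , xsᵢ≡xsⱼ = contradiction xsᵢ≡xsⱼ (lookup-AllPairs xs! i<j)
  where
  lookup-AllPairs : ∀ {A : Set} {R : A → A → Set} {xs} → AllPairs R xs →
                    ∀ {i j} → toℕ i < toℕ j → R (List.lookup xs i) (List.lookup xs j)
  lookup-AllPairs (Rx ∷ _)   {fzero}  {fsuc j} _         = All.lookup Rx (∈-lookup j)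
  lookup-AllPairs (_  ∷ Rxs) {fsuc i} {fsuc j} (s≤s i<j) = lookup-AllPairs Rxs i<j

indicator : Bool → ℕ
indicator b = if b then 1 else 0

countBelow : ℕ → (ℕ → Bool) → ℕ
countBelow zero    g = 0
countBelow (suc i) g = indicator (g i) + countBelow i g

countBelow-suc : ∀ N g → countBelow (suc N) g ≡ indicator (g 0) + countBelow N (g ∘ suc)
countBelow-suc zero    g = refl
countBelow-suc (suc N) g = begin
  indicator (g (suc N)) + countBelow (suc N) g
    ≡⟨ cong (indicator (g (suc N)) +_) (countBelow-suc N g) ⟩
  indicator (g (suc N)) + (indicator (g 0) + countBelow N (g ∘ suc))
    ≡⟨ x∙yz≈y∙xz (indicator (g (suc N))) (indicator (g 0)) _ ⟩
  indicator (g 0) + (indicator (g (suc N)) + countBelow N (g ∘ suc)) ∎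
  where open ≡-Reasoning

countBelow-cong : ∀ K {g h} → (∀ {m} → m < K → g m ≡ h m) → countBelow K g ≡ countBelow K h
countBelow-cong zero    g≡h = refl
countBelow-cong (suc K) g≡h =
  cong₂ (λ b c → indicator b + c) (g≡h ≤-refl) (countBelow-cong K (g≡h ∘ m≤n⇒m≤1+n))

countBelow-vanishing : ∀ {K N g} → K ≤ N → (∀ {m} → K ≤ m → g m ≡ false) →
                       countBelow N g ≡ countBelow K g
countBelow-vanishing {K} {g = g} K≤N g≡false = go (≤⇒≤′ K≤N)
  where
  go : ∀ {N} → K ≤′ N → countBelow N g ≡ countBelow K g
  go ≤′-refl = refl
  go (≤′-step {N} K≤′N) rewrite g≡false (≤′⇒≤ K≤′N) = go K≤′N

countFin-toℕ : ∀ N (P : Fin N → Bool) g → (∀ j → P j ≡ g (toℕ j)) → countFin N P ≡ countBelow N g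
countFin-toℕ N P = go N id
  where
  length-filter-∷ : ∀ {A : Set} (Q : A → Bool) x xs →
    length (filter (λ a → Q a ≟ᵇ true) (x ∷ xs)) ≡
    indicator (Q x) + length (filter (λ a → Q a ≟ᵇ true) xs)
  length-filter-∷ Q x xs with Q x
  ... | true  = refl
  ... | false = refl

  go : ∀ {A : Set} N (t : Fin N → A) {Q : A → Bool} g → (∀ j → Q (t j) ≡ g (toℕ j)) →
       length (filter (λ a → Q a ≟ᵇ true) (List.tabulate t)) ≡ countBelow N g
  go zero    t g Q≡g = refl
  go (suc N) t {Q} g Q≡g = begin
    length (filter (λ a → Q a ≟ᵇ true) (List.tabulate t))
      ≡⟨ length-filter-∷ Q (t fzero) (List.tabulate (t ∘ fsuc)) ⟩
    indicator (Q (t fzero)) + length (filter (λ a → Q a ≟ᵇ true) (List.tabulate (t ∘ fsuc)))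
      ≡⟨ cong₂ (λ b c → indicator b + c) (Q≡g fzero) (go N (t ∘ fsuc) (g ∘ suc) (Q≡g ∘ fsuc)) ⟩
    indicator (g 0) + countBelow N (g ∘ suc)
      ≡⟨ countBelow-suc N g ⟨
    countBelow (suc N) g ∎
    where open ≡-Reasoning

-- Vectors over 𝔽₂ and their spans

infixl 6 _⊕_

_⊕_ : ∀ {k} → Vec Bool k → Vec Bool k → Vec Bool k
_⊕_ = zipWith _xor_

𝟘 : ∀ {k} → Vec Bool k
𝟘 = replicate _ false

⊕-self : ∀ {k} (x : Vec Bool k) → x ⊕ x ≡ 𝟘
⊕-self []      = refl
⊕-self (a ∷ x) = cong₂ _∷_ (xor-same a) (⊕-self x)

module _ {k : ℕ} where

  ⊕-assoc : (x y z : Vec Bool k) → x ⊕ y ⊕ z ≡ x ⊕ (y ⊕ z)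
  ⊕-assoc = zipWith-assoc xor-assoc

  ⊕-comm : (x y : Vec Bool k) → x ⊕ y ≡ y ⊕ x
  ⊕-comm = zipWith-comm xor-comm

  ⊕-identityˡ : (x : Vec Bool k) → 𝟘 ⊕ x ≡ x
  ⊕-identityˡ = zipWith-identityˡ xor-identityˡ

  ⊕-identityʳ : (x : Vec Bool k) → x ⊕ 𝟘 ≡ x
  ⊕-identityʳ = zipWith-identityʳ xor-identityʳ

  ⊕-cancelʳ : (x y : Vec Bool k) → x ⊕ y ⊕ y ≡ x
  ⊕-cancelʳ x y = begin
    x ⊕ y ⊕ y   ≡⟨ ⊕-assoc x y y ⟩
    x ⊕ (y ⊕ y) ≡⟨ cong (x ⊕_) (⊕-self y) ⟩
    x ⊕ 𝟘       ≡⟨ ⊕-identityʳ x ⟩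
    x           ∎
    where open ≡-Reasoning

  ⊕-cancelˡ : (x y : Vec Bool k) → x ⊕ (x ⊕ y) ≡ y
  ⊕-cancelˡ x y = trans (sym (⊕-assoc x x y)) (trans (cong (_⊕ y) (⊕-self x)) (⊕-identityˡ y))

  ⊕-swapʳ : (x y z : Vec Bool k) → x ⊕ y ⊕ z ≡ x ⊕ z ⊕ y
  ⊕-swapʳ x y z = begin
    x ⊕ y ⊕ z   ≡⟨ ⊕-assoc x y z ⟩
    x ⊕ (y ⊕ z) ≡⟨ cong (x ⊕_) (⊕-comm y z) ⟩
    x ⊕ (z ⊕ y) ≡⟨ ⊕-assoc x z y ⟨
    x ⊕ z ⊕ y   ∎
    where open ≡-Reasoning

  ⊕-cancel-shift : (x y z : Vec Bool k) → (x ⊕ z) ⊕ (y ⊕ z) ≡ x ⊕ y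
  ⊕-cancel-shift x y z = begin
    (x ⊕ z) ⊕ (y ⊕ z) ≡⟨ ⊕-assoc (x ⊕ z) y z ⟨
    x ⊕ z ⊕ y ⊕ z     ≡⟨ cong (_⊕ z) (⊕-swapʳ x z y) ⟩
    x ⊕ y ⊕ z ⊕ z     ≡⟨ ⊕-cancelʳ (x ⊕ y) z ⟩
    x ⊕ y             ∎
    where open ≡-Reasoning

  inSpan : List (Vec Bool k) → Vec Bool k → Bool
  inSpan []       x = isYes (≡-dec _≟ᵇ_ x 𝟘)
  inSpan (g ∷ gs) x = inSpan gs x ∨ inSpan gs (x ⊕ g)

  infix 4 _∈⟨_⟩

  _∈⟨_⟩ : Vec Bool k → List (Vec Bool k) → Set
  x ∈⟨ gs ⟩ = T (inSpan gs x)

  private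
    ∨-introˡ : ∀ {a b} → T a → T (a ∨ b)
    ∨-introˡ = Equivalence.from T-∨ ∘ inj₁

    ∨-introʳ : ∀ {a b} → T b → T (a ∨ b)
    ∨-introʳ = Equivalence.from T-∨ ∘ inj₂

    ∨-elim : ∀ {a b} → T (a ∨ b) → T a ⊎ T b
    ∨-elim = Equivalence.to T-∨

  𝟘-∈⟨⟩ : ∀ gs → 𝟘 ∈⟨ gs ⟩
  𝟘-∈⟨⟩ []       = fromWitness refl
  𝟘-∈⟨⟩ (g ∷ gs) = ∨-introˡ (𝟘-∈⟨⟩ gs)

  ⊕-∈⟨⟩ : ∀ gs {x y} → x ∈⟨ gs ⟩ → y ∈⟨ gs ⟩ → x ⊕ y ∈⟨ gs ⟩
  ⊕-∈⟨⟩ [] x∈ y∈ =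
    fromWitness (trans (cong₂ _⊕_ (toWitness x∈) (toWitness y∈)) (⊕-self 𝟘))
  ⊕-∈⟨⟩ (g ∷ gs) {x} {y} x∈ y∈ with ∨-elim x∈ | ∨-elim y∈
  ... | inj₁ x∈′ | inj₁ y∈′ = ∨-introˡ (⊕-∈⟨⟩ gs x∈′ y∈′)
  ... | inj₁ x∈′ | inj₂ y∈′ =
    ∨-introʳ (subst (_∈⟨ gs ⟩) (sym (⊕-assoc x y g)) (⊕-∈⟨⟩ gs x∈′ y∈′))
  ... | inj₂ x∈′ | inj₁ y∈′ =
    ∨-introʳ (subst (_∈⟨ gs ⟩) (⊕-swapʳ x g y) (⊕-∈⟨⟩ gs x∈′ y∈′))
  ... | inj₂ x∈′ | inj₂ y∈′ =
    ∨-introˡ (subst (_∈⟨ gs ⟩) (⊕-cancel-shift x y g) (⊕-∈⟨⟩ gs x∈′ y∈′))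

  ⊕-∈⟨⟩-cancelˡ : ∀ gs {x y} → x ⊕ y ∈⟨ gs ⟩ → x ∈⟨ gs ⟩ → y ∈⟨ gs ⟩
  ⊕-∈⟨⟩-cancelˡ gs {x} {y} xy∈ x∈ = subst (_∈⟨ gs ⟩) (⊕-cancelˡ x y) (⊕-∈⟨⟩ gs x∈ xy∈)

  ⊕-∈⟨⟩-cancelʳ : ∀ gs {x y} → x ⊕ y ∈⟨ gs ⟩ → y ∈⟨ gs ⟩ → x ∈⟨ gs ⟩
  ⊕-∈⟨⟩-cancelʳ gs {x} {y} xy∈ y∈ = subst (_∈⟨ gs ⟩) (⊕-cancelʳ x y) (⊕-∈⟨⟩ gs xy∈ y∈)

  ∈⟨⟩-∷ : ∀ g gs {x} → x ∈⟨ gs ⟩ → x ∈⟨ g ∷ gs ⟩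
  ∈⟨⟩-∷ g gs = ∨-introˡ

  ∈⟨⟩-++ : ∀ hs gs {x} → x ∈⟨ gs ⟩ → x ∈⟨ hs ++ gs ⟩
  ∈⟨⟩-++ []       gs x∈ = x∈
  ∈⟨⟩-++ (h ∷ hs) gs x∈ = ∈⟨⟩-∷ h (hs ++ gs) (∈⟨⟩-++ hs gs x∈)

  head-∈⟨⟩ : ∀ g gs → g ∈⟨ g ∷ gs ⟩
  head-∈⟨⟩ g gs = ∨-introʳ (subst (_∈⟨ gs ⟩) (sym (⊕-self g)) (𝟘-∈⟨⟩ gs))

  ∈⇒∈⟨⟩ : ∀ {gs x} → x ∈ gs → x ∈⟨ gs ⟩
  ∈⇒∈⟨⟩ {g ∷ gs} (here refl) = head-∈⟨⟩ g gs
  ∈⇒∈⟨⟩ {g ∷ gs} (there x∈)  = ∈⟨⟩-∷ g gs (∈⇒∈⟨⟩ x∈)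

  ∈⟨∷⟩⇒⊕∈⟨⟩ : ∀ g gs {x} → x ∈⟨ g ∷ gs ⟩ → ¬ x ∈⟨ gs ⟩ → x ⊕ g ∈⟨ gs ⟩
  ∈⟨∷⟩⇒⊕∈⟨⟩ g gs x∈ x∉ with ∨-elim x∈
  ... | inj₁ x∈′ = ⊥-elim (x∉ x∈′)
  ... | inj₂ x⊕g∈ = x⊕g∈

  ∈⟨⟩-induction : (Q : Vec Bool k → Set) → Q 𝟘 → (∀ {x y} → Q x → Q y → Q (x ⊕ y)) →
                  ∀ {gs} → All Q gs → ∀ {x} → x ∈⟨ gs ⟩ → Q x
  ∈⟨⟩-induction Q Q𝟘 Q⊕ {[]} [] x∈ = subst Q (sym (toWitness x∈)) Q𝟘
  ∈⟨⟩-induction Q Q𝟘 Q⊕ {g ∷ gs} (Qg ∷ Qgs) {x} x∈ with ∨-elim x∈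
  ... | inj₁ x∈′  = ∈⟨⟩-induction Q Q𝟘 Q⊕ Qgs x∈′
  ... | inj₂ x⊕g∈ = subst Q (⊕-cancelʳ x g) (Q⊕ (∈⟨⟩-induction Q Q𝟘 Q⊕ Qgs x⊕g∈) Qg)

  -- Elements of span(b ∷ L ++ gens) outside span(L ++ gens) are moved into it by x ↦ x ⊕ b,
  -- which preserves pairwise inequivalence modulo span(gens).
  inequivalent⇒length≤2^ : ∀ gens L xs → All (_∈⟨ L ++ gens ⟩) xs →
                           AllPairs (λ x y → ¬ x ⊕ y ∈⟨ gens ⟩) xs → length xs ≤ 2 ^ length L
  inequivalent⇒length≤2^ gens [] []           _             _               = z≤n
  inequivalent⇒length≤2^ gens [] (x ∷ [])     _             _               = s≤s z≤n
  inequivalent⇒length≤2^ gens [] (x ∷ y ∷ xs) (x∈ ∷ y∈ ∷ _) ((x≁y ∷ _) ∷ _) =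
    ⊥-elim (x≁y (⊕-∈⟨⟩ gens x∈ y∈))
  inequivalent⇒length≤2^ gens (b ∷ L) xs xs∈ xs≁ = begin
    length xs                             ≡⟨ length-filter-∁ P? xs ⟨
    length ins + length outs              ≡⟨ cong (length ins +_) (length-map (_⊕ b) outs) ⟨
    length ins + length (map (_⊕ b) outs) ≤⟨ +-mono-≤ (ih ins ins∈ ins≁) (ih _ outs⊕b∈ outs⊕b≁) ⟩
    2 ^ length L + 2 ^ length L           ≡⟨ cong (2 ^ length L +_) (+-identityʳ _) ⟨
    2 ^ length (b ∷ L)                    ∎
    where
    open ≤-Reasoning
    ih = inequivalent⇒length≤2^ gens L
    P? = λ x → T? (inSpan (L ++ gens) x)
    ins  = filter P? xs
    outs = filter (∁? P?) xs
    ins∈ : All (_∈⟨ L ++ gens ⟩) ins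
    ins∈ = Allₚ.all-filter P? xs
    ins≁ : AllPairs (λ x y → ¬ x ⊕ y ∈⟨ gens ⟩) ins
    ins≁ = AllPairsₚ.filter⁺ P? xs≁
    outs⊕b∈ : All (_∈⟨ L ++ gens ⟩) (map (_⊕ b) outs)
    outs⊕b∈ = Allₚ.map⁺ (All.map (λ (x∈ , x∉) → ∈⟨∷⟩⇒⊕∈⟨⟩ b (L ++ gens) x∈ x∉)
                                 (All.zip (Allₚ.filter⁺ (∁? P?) xs∈ , Allₚ.all-filter (∁? P?) xs)))
    outs⊕b≁ : AllPairs (λ x y → ¬ x ⊕ y ∈⟨ gens ⟩) (map (_⊕ b) outs)
    outs⊕b≁ = AllPairsₚ.map⁺
      (AllPairs.map (λ {x} {y} x≁y → x≁y ∘ subst (_∈⟨ gens ⟩) (⊕-cancel-shift x y b))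
                    (AllPairsₚ.filter⁺ (∁? P?) xs≁))

module GreedyBasis {k} (gens : List (Vec Bool k)) (f : ℕ → Vec Bool k) where

  basis : ℕ → List (Vec Bool k)
  basis zero    = []
  basis (suc i) = if inSpan (basis i ++ gens) (f i) then basis i else f i ∷ basis i

  isNew : ℕ → Bool
  isNew i = not (inSpan (basis i ++ gens) (f i))

  isNew⇒∉ : ∀ {i} → T (isNew i) → ¬ f i ∈⟨ basis i ++ gens ⟩
  isNew⇒∉ {i} new f∈ with inSpan (basis i ++ gens) (f i)
  ... | true  = new
  ... | false = f∈

  length-basis : ∀ i → length (basis i) ≡ countBelow i isNew
  length-basis zero = refl
  length-basis (suc i) with inSpan (basis i ++ gens) (f i)
  ... | true  = length-basis i
  ... | false = cong suc (length-basis i)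

  f-∈⟨basis⟩ : ∀ i → f i ∈⟨ basis (suc i) ++ gens ⟩
  f-∈⟨basis⟩ i with inSpan (basis i ++ gens) (f i) in eq
  ... | true  = subst T (sym eq) _
  ... | false = head-∈⟨⟩ (f i) (basis i ++ gens)

  basis-step : ∀ i {x} → x ∈⟨ basis i ++ gens ⟩ → x ∈⟨ basis (suc i) ++ gens ⟩
  basis-step i x∈ with inSpan (basis i ++ gens) (f i)
  ... | true  = x∈
  ... | false = ∈⟨⟩-∷ (f i) (basis i ++ gens) x∈

  basis-mono : ∀ {i j x} → i ≤ j → x ∈⟨ basis i ++ gens ⟩ → x ∈⟨ basis j ++ gens ⟩
  basis-mono = mono′ ∘ ≤⇒≤′
    where
    mono′ : ∀ {i j x} → i ≤′ j → x ∈⟨ basis i ++ gens ⟩ → x ∈⟨ basis j ++ gens ⟩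
    mono′ ≤′-refl              x∈ = x∈
    mono′ (≤′-step {j} i≤′j) x∈ = basis-step j (mono′ i≤′j x∈)

  ≤2^length-basis : ∀ K → (∀ {i j} → i < j → j < K → ¬ f i ⊕ f j ∈⟨ gens ⟩) →
                    K ≤ 2 ^ length (basis K)
  ≤2^length-basis K f-inequivalent = subst (_≤ 2 ^ length (basis K)) (length-applyUpTo f K)
    (inequivalent⇒length≤2^ gens (basis K) (applyUpTo f K)
      (Allₚ.applyUpTo⁺₁ f K (λ {i} i<K → basis-mono i<K (f-∈⟨basis⟩ i)))
      (AllPairsₚ.applyUpTo⁺₁ f K f-inequivalent))

-- Colour parities of walks

isOdd : ℕ → Bool
isOdd zero    = false
isOdd (suc m) = not (isOdd m)

isOdd≡false⇒2∣ : ∀ m → isOdd m ≡ false → 2 ∣ m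
isOdd≡false⇒2∣ zero          _ = divides-refl 0
isOdd≡false⇒2∣ (suc (suc m)) e with isOdd m in eq
... | false = ∣m∣n⇒∣m+n {2} {2} ∣-refl (isOdd≡false⇒2∣ m eq)

module _ {k : ℕ} where

  unitVec : Fin k → Vec Bool k
  unitVec a = tabulate (λ b → isYes (b ≟ᶠ a))

  parityVector : List (Fin k) → Vec Bool k
  parityVector []       = 𝟘
  parityVector (a ∷ as) = unitVec a ⊕ parityVector as

  parityVector-++ : ∀ as bs → parityVector (as ++ bs) ≡ parityVector as ⊕ parityVector bs
  parityVector-++ []       bs = sym (⊕-identityˡ (parityVector bs))
  parityVector-++ (a ∷ as) bs =
    trans (cong (unitVec a ⊕_) (parityVector-++ as bs)) (sym (⊕-assoc (unitVec a) _ _))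

  lookup-parityVector : ∀ as b → lookup (parityVector as) b ≡ isOdd (count b as)
  lookup-parityVector []       b = lookup-replicate b false
  lookup-parityVector (a ∷ as) b = begin
    lookup (unitVec a ⊕ parityVector as) b
      ≡⟨ lookup-zipWith _xor_ b (unitVec a) (parityVector as) ⟩
    lookup (unitVec a) b xor lookup (parityVector as) b
      ≡⟨ cong₂ _xor_ (lookup∘tabulate _ b) (lookup-parityVector as b) ⟩
    isYes (b ≟ᶠ a) xor isOdd (count b as)
      ≡⟨ xor-count ⟩
    isOdd (count b (a ∷ as)) ∎
    where
    open ≡-Reasoning
    xor-count : isYes (b ≟ᶠ a) xor isOdd (count b as) ≡ isOdd (count b (a ∷ as))
    xor-count with b ≟ᶠ a
    ... | yes _ = refl
    ... | no  _ = refl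

  parityVector≡𝟘⇒even : ∀ as → parityVector as ≡ 𝟘 → ∀ b → 2 ∣ count b as
  parityVector≡𝟘⇒even as as≡𝟘 b = isOdd≡false⇒2∣ _ (begin
    isOdd (count b as)         ≡⟨ lookup-parityVector as b ⟨
    lookup (parityVector as) b ≡⟨ cong (λ v → lookup v b) as≡𝟘 ⟩
    lookup 𝟘 b                 ≡⟨ lookup-replicate b false ⟩
    false                      ∎)
    where open ≡-Reasoning

module WalkParity {n k} {G : Graph n} (c : EdgeColoring G k) where

  infixr 5 _▻▻_ _▻▻ₚ_

  _▻▻_ : ∀ {u v w} → Walk G u v → Walk G v w → Walk G u w
  p ▻▻ here     = p
  p ▻▻ step q a = step (p ▻▻ q) a

  walkColors-▻▻ : ∀ {u v w} (p : Walk G u v) (q : Walk G v w) →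
                  walkColors c (p ▻▻ q) ≡ walkColors c q ++ walkColors c p
  walkColors-▻▻ p here       = refl
  walkColors-▻▻ p (step q a) = cong (_ ∷_) (walkColors-▻▻ p q)

  parity : ∀ {u v} → Walk G u v → Vec Bool k
  parity p = parityVector (walkColors c p)

  WalkOfParity : Fin n → Fin n → Vec Bool k → Set
  WalkOfParity u v x = Σ (Walk G u v) (λ p → parity p ≡ x)

  empty-walk : ∀ {u} → WalkOfParity u u 𝟘
  empty-walk = here , refl

  edge-walk : ∀ {u v} → adj G u v ≡ true → WalkOfParity u v (unitVec (col c u v))
  edge-walk a = step here a , ⊕-identityʳ _

  _▻▻ₚ_ : ∀ {u v w x y} → WalkOfParity u v x → WalkOfParity v w y → WalkOfParity u w (x ⊕ y)
  (p , refl) ▻▻ₚ (q , refl) =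
    p ▻▻ q , trans (cong parityVector (walkColors-▻▻ p q))
                   (trans (parityVector-++ (walkColors c q) (walkColors c p)) (⊕-comm _ _))

  reverse-walk : ∀ {u v x} → WalkOfParity u v x → WalkOfParity v u x
  reverse-walk (p , refl) = reverse p
    where
    reverse : ∀ {u v} (p : Walk G u v) → WalkOfParity v u (parity p)
    reverse here = empty-walk
    reverse (step {v} {w} p a) =
      subst (WalkOfParity w _) (cong (λ b → unitVec b ⊕ parity p) (col-sym c w v a′))
            (edge-walk a′ ▻▻ₚ reverse p)
      where a′ = trans (adj-sym G w v) a

  module _ (strong : IsStrongParity c) where

    no-open-even-walk : ∀ {u v} → u ≢ v → ¬ WalkOfParity u v 𝟘
    no-open-even-walk {u} {v} u≢v (p , p≡𝟘) =
      strong u v p u≢v (parityVector≡𝟘⇒even (walkColors c p) p≡𝟘)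

    strongParity⇒proper : ∀ {u v w} → u ≢ w → adj G u v ≡ true → adj G w v ≡ true →
                          col c u v ≢ col c w v
    strongParity⇒proper {u} {v} {w} u≢w uv wv same =
      no-open-even-walk u≢w (subst (WalkOfParity u w) (⊕-self _) (edge-walk uv ▻▻ₚ reverse-walk vw))
      where
      vw : WalkOfParity w v (unitVec (col c u v))
      vw = subst (WalkOfParity w v ∘ unitVec) (sym same) (edge-walk wv)

module ParityPotential {n k} {G : Graph n} (c : EdgeColoring G k) (conn : Connected G) (r : Fin n)
  where

  open WalkParity c

  potential : Fin n → Vec Bool k
  potential v = parity (conn r v)

  -- The parity of the closed walk r ⇝ u → w ⇝ r; non-edges contribute the harmless 𝟘.
  edgeCycle : Fin n → Fin n → Vec Bool k
  edgeCycle u w = if adj G u w then potential u ⊕ unitVec (col c u w) ⊕ potential w else 𝟘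

  edgeCycles : List (Vec Bool k)
  edgeCycles = List.concat (List.tabulate λ u → List.tabulate λ w → edgeCycle u w)

  cycleVectors : List (Vec Bool k)
  cycleVectors = potential r ∷ edgeCycles

  closedWalk : ∀ {x} → x ∈⟨ cycleVectors ⟩ → WalkOfParity r r x
  closedWalk = ∈⟨⟩-induction (WalkOfParity r r) empty-walk _▻▻ₚ_
    ((conn r r , refl) ∷ Allₚ.concat⁺ (Allₚ.tabulate⁺ λ u → Allₚ.tabulate⁺ (edgeCycle-closed u)))
    where
    edgeCycle-closed : ∀ u w → WalkOfParity r r (edgeCycle u w)
    edgeCycle-closed u w with adj G u w in uw
    ... | true  = ((conn r u , refl) ▻▻ₚ edge-walk uw) ▻▻ₚ reverse-walk (conn r w , refl)
    ... | false = empty-walk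

  potential-root-∈ : potential r ∈⟨ cycleVectors ⟩
  potential-root-∈ = head-∈⟨⟩ (potential r) edgeCycles

  edgeCycle-∈ : ∀ {u w} → adj G u w ≡ true →
                potential u ⊕ unitVec (col c u w) ⊕ potential w ∈⟨ cycleVectors ⟩
  edgeCycle-∈ {u} {w} uw = subst (_∈⟨ cycleVectors ⟩) edgeCycle-adj
    (∈⇒∈⟨⟩ (there (∈-concat⁺′ (∈-tabulate⁺ w) (∈-tabulate⁺ u))))
    where
    edgeCycle-adj : edgeCycle u w ≡ potential u ⊕ unitVec (col c u w) ⊕ potential w
    edgeCycle-adj rewrite uw = refl

  module _ (hs : List (Vec Bool k)) {u w} (uw : adj G u w ≡ true) where

    private
      cycle∈ : potential u ⊕ unitVec (col c u w) ⊕ potential w ∈⟨ hs ++ cycleVectors ⟩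
      cycle∈ = ∈⟨⟩-++ hs cycleVectors (edgeCycle-∈ uw)

    edge-colour-∈ : potential u ∈⟨ hs ++ cycleVectors ⟩ → potential w ∈⟨ hs ++ cycleVectors ⟩ →
                    unitVec (col c u w) ∈⟨ hs ++ cycleVectors ⟩
    edge-colour-∈ u∈ w∈ =
      ⊕-∈⟨⟩-cancelˡ (hs ++ cycleVectors) (⊕-∈⟨⟩-cancelʳ (hs ++ cycleVectors) cycle∈ w∈) u∈

    edge-potential-∈ : potential u ∈⟨ hs ++ cycleVectors ⟩ →
                       unitVec (col c u w) ∈⟨ hs ++ cycleVectors ⟩ →
                       potential w ∈⟨ hs ++ cycleVectors ⟩
    edge-potential-∈ u∈ e∈ =
      ⊕-∈⟨⟩-cancelˡ (hs ++ cycleVectors) cycle∈ (⊕-∈⟨⟩ (hs ++ cycleVectors) u∈ e∈)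

  potentials-inequivalent : IsStrongParity c → ∀ {u v} → u ≢ v →
                            ¬ potential u ⊕ potential v ∈⟨ cycleVectors ⟩
  potentials-inequivalent strong {u} {v} u≢v uv∈ = no-open-even-walk strong u≢v
    (subst (WalkOfParity u v) u⊕[u⊕v]⊕v≡𝟘
      (reverse-walk (conn r u , refl) ▻▻ₚ closedWalk uv∈ ▻▻ₚ (conn r v , refl)))
    where
    u⊕[u⊕v]⊕v≡𝟘 : potential u ⊕ (potential u ⊕ potential v ⊕ potential v) ≡ 𝟘
    u⊕[u⊕v]⊕v≡𝟘 = trans (cong (potential u ⊕_) (⊕-cancelʳ _ _)) (⊕-self (potential u))

-- The saturating set

module SaturatingSet {m k} {G : Graph (suc m)} (σ : Permutation′ (suc m)) (conn : Connected G)
                     (c : EdgeColoring G k) (strong : IsStrongParity c) where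

  open WalkParity c using (strongParity⇒proper)
  open ParityPotential c conn (σ ⟨$⟩ʳ fzero)

  -- Positions are natural numbers so that the greedy basis can recurse on them;
  -- positions ≥ n are junk and never used.
  vertexAt : ℕ → Fin (suc m)
  vertexAt i = σ ⟨$⟩ʳ (i mod suc m)

  open GreedyBasis cycleVectors (potential ∘ vertexAt)

  saturatingSet : Fin (suc m) → Bool
  saturatingSet v = isNew (toℕ (σ ⟨$⟩ˡ v))

  toℕ-mod : ∀ {i} → i < suc m → toℕ (i mod suc m) ≡ i
  toℕ-mod i<n = trans (toℕ-fromℕ< _) (m<n⇒m%n≡m i<n)

  vertexAt-toℕ : ∀ j → vertexAt (toℕ j) ≡ σ ⟨$⟩ʳ j
  vertexAt-toℕ j = cong (σ ⟨$⟩ʳ_) (toℕ-injective (toℕ-mod (toℕ<n j)))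

  vertexAt-injective : ∀ {i j} → i < suc m → j < suc m → vertexAt i ≡ vertexAt j → i ≡ j
  vertexAt-injective i<n j<n eq =
    trans (sym (toℕ-mod i<n)) (trans (cong toℕ (Injection.injective (↔⇒↣ σ) eq)) (toℕ-mod j<n))

  saturatingSet-σ : ∀ j → saturatingSet (σ ⟨$⟩ʳ j) ≡ isNew (toℕ j)
  saturatingSet-σ j = cong (isNew ∘ toℕ) (inverseˡ σ)

  -- satCount ignores position 0, which is consistent because v₁ is never new.
  isNew-0 : isNew 0 ≡ false
  isNew-0 = cong not (Equivalence.to T-≡ potential-root-∈)

  potential-earlier-∈ : ∀ {j K} → toℕ j < K → potential (σ ⟨$⟩ʳ j) ∈⟨ basis K ++ cycleVectors ⟩
  potential-earlier-∈ {j} {K} j<K =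
    subst (λ v → potential v ∈⟨ basis K ++ cycleVectors ⟩) (vertexAt-toℕ j)
          (basis-mono j<K (f-∈⟨basis⟩ (toℕ j)))

  satCount≡length-basis : ∀ {K} → K ≤ suc m → satCount σ saturatingSet K ≡ length (basis K)
  satCount≡length-basis {K} K≤n = begin
    satCount σ saturatingSet K
      ≡⟨ countFin-toℕ (suc m) _ inWindow
           (λ j → cong (λ b → if (0 <ᵇ toℕ j) ∧ (toℕ j <ᵇ K) then b else false) (saturatingSet-σ j)) ⟩
    countBelow (suc m) inWindow ≡⟨ countBelow-vanishing K≤n beyond ⟩
    countBelow K inWindow       ≡⟨ countBelow-cong K below ⟩
    countBelow K isNew          ≡⟨ length-basis K ⟨
    length (basis K)            ∎
    where
    open ≡-Reasoning
    inWindow : ℕ → Bool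
    inWindow i = if (0 <ᵇ i) ∧ (i <ᵇ K) then isNew i else false

    beyond : ∀ {i} → K ≤ i → inWindow i ≡ false
    beyond {i} K≤i with i <ᵇ K | <ᵇ⇒< i K
    ... | true  | i<K = contradiction (i<K _) (≤⇒≯ K≤i)
    ... | false | _   = cong (λ b → if b then isNew i else false) (∧-zeroʳ (0 <ᵇ i))

    below : ∀ {i} → i < K → inWindow i ≡ isNew i
    below {zero}  _   = sym isNew-0
    below {suc i} i<K with suc i <ᵇ K | <⇒<ᵇ i<K
    ... | true | _ = refl

  saturating : Saturating σ saturatingSet
  saturating K _ K≤n = begin
    ⌈log₂ K ⌉                       ≤⟨ ⌈log₂⌉-mono-≤ (≤2^length-basis K inequivalent) ⟩
    ⌈log₂ (2 ^ length (basis K)) ⌉ ≡⟨ ⌈log₂2^n⌉≡n _ ⟩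
    length (basis K)                ≡⟨ satCount≡length-basis K≤n ⟨
    satCount σ saturatingSet K      ∎
    where
    open ≤-Reasoning
    inequivalent : ∀ {i j} → i < j → j < K →
                   ¬ potential (vertexAt i) ⊕ potential (vertexAt j) ∈⟨ cycleVectors ⟩
    inequivalent i<j j<K = potentials-inequivalent strong
      (<⇒≢ i<j ∘ vertexAt-injective (<-trans i<j (≤-trans j<K K≤n)) (≤-trans j<K K≤n))

  isBackNeighbour : Fin (suc m) → Fin (suc m) → Bool
  isBackNeighbour i j = if toℕ j <ᵇ toℕ i then adj G (σ ⟨$⟩ʳ j) (σ ⟨$⟩ʳ i) else false

  isBackNeighbour? : ∀ i → Decidable (λ j → isBackNeighbour i j ≡ true)
  isBackNeighbour? i j = isBackNeighbour i j ≟ᵇ true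

  backNeighbours : Fin (suc m) → List (Fin (suc m))
  backNeighbours i = filter (isBackNeighbour? i) (allFin (suc m))

  backColour : Fin (suc m) → Fin (suc m) → Fin k
  backColour i j = col c (σ ⟨$⟩ʳ j) (σ ⟨$⟩ʳ i)

  selectedBackColours : Fin (suc m) → List (Fin k)
  selectedBackColours i = if isNew (toℕ i) then map (backColour i) (backNeighbours i) else []

  isBackNeighbour⇒ : ∀ {i j} → isBackNeighbour i j ≡ true →
                     toℕ j < toℕ i × adj G (σ ⟨$⟩ʳ j) (σ ⟨$⟩ʳ i) ≡ true
  isBackNeighbour⇒ {i} {j} back with toℕ j <ᵇ toℕ i | <ᵇ⇒< (toℕ j) (toℕ i)
  ... | true | j<i = j<i _ , back

  length-selectedBackColours : ∀ i →
    length (selectedBackColours i) ≡ (if saturatingSet (σ ⟨$⟩ʳ i) then backDeg G σ i else 0)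
  length-selectedBackColours i rewrite saturatingSet-σ i with isNew (toℕ i)
  ... | true  = length-map (backColour i) (backNeighbours i)
  ... | false = refl

  ∈-selectedBackColours⁻ : ∀ {i a} → a ∈ selectedBackColours i →
    T (isNew (toℕ i)) × Σ (Fin (suc m)) (λ j → isBackNeighbour i j ≡ true × a ≡ backColour i j)
  ∈-selectedBackColours⁻ {i} a∈ with isNew (toℕ i)
  ... | true with j , j∈ , refl ← ∈-map⁻ (backColour i) a∈ =
    _ , j , proj₂ (∈-filter⁻ (isBackNeighbour? i) j∈) , refl

  backColour-∈ : ∀ {i j K} → isBackNeighbour i j ≡ true → toℕ i < K →
                 unitVec (backColour i j) ∈⟨ basis K ++ cycleVectors ⟩
  backColour-∈ {K = K} back i<K with j<i , ji ← isBackNeighbour⇒ back =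
    edge-colour-∈ (basis K) ji (potential-earlier-∈ (<-trans j<i i<K)) (potential-earlier-∈ i<K)

  backColour-∉ : ∀ {i j} → T (isNew (toℕ i)) → isBackNeighbour i j ≡ true →
                 ¬ unitVec (backColour i j) ∈⟨ basis (toℕ i) ++ cycleVectors ⟩
  backColour-∉ {i} new back e∈ with j<i , ji ← isBackNeighbour⇒ back =
    isNew⇒∉ {toℕ i} new
      (subst (λ v → potential v ∈⟨ basis (toℕ i) ++ cycleVectors ⟩) (sym (vertexAt-toℕ i))
             (edge-potential-∈ (basis (toℕ i)) ji (potential-earlier-∈ j<i) e∈))

  Unique-selectedBackColours : ∀ i → Unique (selectedBackColours i)
  Unique-selectedBackColours i with isNew (toℕ i)
  ... | false = []
  ... | true  = Unique-map⁺ (Allₚ.all-filter (isBackNeighbour? i) (allFin (suc m)))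
                            backColour-injective
                            (AllPairsₚ.filter⁺ (isBackNeighbour? i) (Uniqueₚ.allFin⁺ (suc m)))
    where
    backColour-injective : ∀ {j j′} → isBackNeighbour i j ≡ true → isBackNeighbour i j′ ≡ true →
                           j ≢ j′ → backColour i j ≢ backColour i j′
    backColour-injective j-back j′-back j≢j′ =
      strongParity⇒proper strong (j≢j′ ∘ Injection.injective (↔⇒↣ σ))
        (proj₂ (isBackNeighbour⇒ j-back)) (proj₂ (isBackNeighbour⇒ j′-back))

  backColours-distinct : ∀ {i j i′ j′} → toℕ i < toℕ i′ → isBackNeighbour i j ≡ true →
    T (isNew (toℕ i′)) → isBackNeighbour i′ j′ ≡ true → backColour i j ≢ backColour i′ j′
  backColours-distinct {i′ = i′} i<i′ back new′ back′ same =
    backColour-∉ new′ back′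
      (subst (λ a → unitVec a ∈⟨ basis (toℕ i′) ++ cycleVectors ⟩) same (backColour-∈ back i<i′))

  Disjoint-selectedBackColours : ∀ {i i′} → i ≢ i′ →
                                 Disjoint (selectedBackColours i) (selectedBackColours i′)
  Disjoint-selectedBackColours {i} {i′} i≢i′ (a∈ , a∈′)
    with new , j , back , a≡ ← ∈-selectedBackColours⁻ {i} a∈
       | new′ , j′ , back′ , a≡′ ← ∈-selectedBackColours⁻ {i′} a∈′
    with <-cmp (toℕ i) (toℕ i′)
  ... | tri< i<i′ _ _ = backColours-distinct i<i′ back new′ back′ (trans (sym a≡) a≡′)
  ... | tri≈ _ i≡i′ _ = i≢i′ (toℕ-injective i≡i′)
  ... | tri> _ _ i′<i = backColours-distinct i′<i back′ new back (trans (sym a≡′) a≡)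

  sumBackDeg≤k : sumBackDeg G σ saturatingSet ≤ k
  sumBackDeg≤k = begin
    sumBackDeg G σ saturatingSet
      ≡⟨ cong sum (map-cong length-selectedBackColours (allFin (suc m))) ⟨
    sum (map (length ∘ selectedBackColours) (allFin (suc m)))
      ≡⟨ cong sum (map-∘ (allFin (suc m))) ⟩
    sum (map length (map selectedBackColours (allFin (suc m))))
      ≡⟨ length-concat (map selectedBackColours (allFin (suc m))) ⟨
    length (List.concat (map selectedBackColours (allFin (suc m))))
      ≤⟨ Unique⇒length≤ _ (Uniqueₚ.concat⁺
           (Allₚ.map⁺ (Allₚ.tabulate⁺ {f = λ i → i} Unique-selectedBackColours))
           (AllPairsₚ.map⁺ (AllPairs.map Disjoint-selectedBackColours (Uniqueₚ.allFin⁺ (suc m))))) ⟩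
    k ∎
    where open ≤-Reasoning

lemma3p3 : ∀ (n : ℕ) (G : Graph n) (σ : Permutation′ n) → Connected G → GoodOrdering G σ →
    ∀ (k : ℕ) (c : EdgeColoring G k) → IsStrongParity c →
    Σ (Fin n → Bool) (λ T → Saturating σ T × sumBackDeg G σ T ≤ k)
lemma3p3 zero    G σ conn _ k c strong = (λ ()) , (λ { _ (s≤s _) () }) , z≤n
lemma3p3 (suc m) G σ conn _ k c strong = saturatingSet , saturating , sumBackDeg≤k
  where open SaturatingSet σ conn c strong
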